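{- For every integer $n\ge 1$, $$\sum_{i=0}^n\frac{(i-1)B_i}{(n-i+2)!\,i!}=\begin{cases}0 & \text{if $n$ is even},\\ -B_{n+1}/n! & \text{if $n$ is odd}.\end{cases}$$
   Context: $B_n$ denote the Bernoulli numbers, defined by $\frac{t}{e^t-1}=\sum_{n\ge0}B_n\frac{t^n}{n!}$ (so $B_1=-1/2$). -}

module Defs where

open import Data.Nat as ℕ using (ℕ; zero; suc; _∸_; _!)
open import Data.Nat.Properties using (_!*_!≢0; _!≢0)
open import Data.Nat.Combinatorics using (_C_)
open import Data.Integer as ℤ using (ℤ; +_)
open import Data.Rational using (ℚ; 0ℚ; 1ℚ; _+_; _-_; _*_; -_; _/_)
open import Data.List using (List; []; _∷_; _++_; [_]; length; lookup; upTo; map; foldr; zipWith)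

ℕ→ℚ : ℕ → ℚ
ℕ→ℚ n = (+ n) / 1

sumTo : ℕ → (ℕ → ℚ) → ℚ
sumTo zero    f = f 0
sumTo (suc n) f = sumTo n f + f (suc n)

-- Given [B_0, …, B_{m-1}] (length m), compute B_m via the standard recurrence
-- coming from t/(e^t-1) = Σ B_n t^n/n! :
--   Σ_{k=0}^{m} C(m+1,k) B_k = 0  (m ≥ 1),  B_0 = 1.
nextB : ℕ → List ℚ → ℚ
nextB zero    _  = 1ℚ
nextB (suc m) bs =
  - ((+ 1 / suc (suc m)) *
     foldr _+_ 0ℚ (zipWith (λ k b → ℕ→ℚ (suc (suc m) C k) * b) (upTo (suc m)) bs))

bernList : ℕ → List ℚ
bernList zero    = [ 1ℚ ]
bernList (suc m) = bernList m ++ [ nextB (suc m) (bernList m) ]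

-- Bernoulli numbers with B_1 = -1/2
B : ℕ → ℚ
B n = last (bernList n)
  where
  last : List ℚ → ℚ
  last []           = 0ℚ
  last (x ∷ [])     = x
  last (_ ∷ y ∷ ys) = last (y ∷ ys)

-- the summand (i-1) B_i / ((n-i+2)! i!)   (for 0 ≤ i ≤ n, so n-i+2 = (n+2) ∸ i)
summand : ℕ → ℕ → ℚ
summand n i = (ℕ→ℚ i - 1ℚ) * B i * ((+ 1) / ((suc (suc n) ∸ i) ! ℕ.* i !))
  where instance _ = (suc (suc n) ∸ i) !* i !≢0

rhsOdd : ℕ → ℚ
rhsOdd n = - (B (suc n) * ((+ 1) / (n !)))
  where instance _ = n !≢0

{-# OPTIONS --safe #-}
-- Put a i = B i / i!. Then A = Σ a i tⁱ is t/(eᵗ − 1), and the sum is the coefficient of tⁿ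
-- in (θA − A)·(eᵗ − 1 − t)/t², where θ = t d/dt. From A·(eᵗ − 1)/t = 1 one gets
-- A·eᵗ = A + t, and then, by the Leibniz rule for θ, t·(θA − A)·(eᵗ − 1 − t)/t² = −t − θA;
-- so for n ≥ 1 the sum is −(n + 1) a (n + 1) = −B (n + 1)/n!. Multiplying A·eᵗ = A + t by
-- (1 − e⁻ᵗ)/t shows A(−t) = A(t) + t, so a m = 0 for odd m ≥ 3, which is the even case.
module Submission where

open import Defs

module BernoulliGeneratingFunction where
  open import Data.Nat as ℕ using (ℕ; zero; suc; _∸_; _!; _≤_; z≤n; s≤s; NonZero)
  import Data.Nat.Properties as ℕ
  open import Data.Nat.Properties using (_!≢0; _!*_!≢0)
  open import Data.Nat.Combinatorics using (_C_; nCk≡n!/k![n-k]!; k![n∸k]!∣n!; nCk≡nC[n∸k]; nC1≡n)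
  open import Data.Nat.DivMod using (m/n*n≡m)
  open import Data.Nat.Coprimality using (1-coprimeTo) renaming (sym to coprime-sym)
  import Data.Integer as ℤ
  import Data.Integer.Properties as ℤ
  open import Data.Rational using (ℚ; 0ℚ; 1ℚ; _+_; _*_; -_; _-_; _/_; mkℚ)
  open import Data.Rational.Properties
  open import Data.Rational.Solver using (module +-*-Solver)
  open +-*-Solver
  open import Algebra.Properties.Group +-0-group using (inverseˡ-unique; x≈z//y)
    renaming (∙-cancelˡ to +-cancelˡ)
  open import Data.List using (List; []; _∷_; [_]; _∷ʳ_; foldr; zipWith; applyUpTo; upTo)
  open import Data.List.Properties using (applyUpTo-∷ʳ)
  open import Data.Sum using (inj₁; inj₂)
  open import Function using (_∘_; id)
  open import Relation.Binary.PropositionalEquality hiding ([_])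
  open ≡-Reasoning

  ℕ→mkℚ : ℕ → ℚ
  ℕ→mkℚ n = mkℚ (ℤ.+ n) 0 (coprime-sym (1-coprimeTo n))

  ℕ→ℚ≡ℕ→mkℚ : ∀ n → ℕ→ℚ n ≡ ℕ→mkℚ n
  ℕ→ℚ≡ℕ→mkℚ n = normalize-coprime (coprime-sym (1-coprimeTo n))

  ℕ→ℚ-+ : ∀ m n → ℕ→ℚ (m ℕ.+ n) ≡ ℕ→ℚ m + ℕ→ℚ n
  ℕ→ℚ-+ m n = begin
    ℕ→ℚ (m ℕ.+ n)
      ≡⟨ /-cong {ℤ.+ (m ℕ.+ n)} {1} {ℤ.+ m ℤ.* ℤ.+ 1 ℤ.+ ℤ.+ n ℤ.* ℤ.+ 1} {1} numerator refl ⟩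
    ℕ→mkℚ m + ℕ→mkℚ n
      ≡⟨ sym (cong₂ _+_ (ℕ→ℚ≡ℕ→mkℚ m) (ℕ→ℚ≡ℕ→mkℚ n)) ⟩
    ℕ→ℚ m + ℕ→ℚ n ∎
    where
    numerator : ℤ.+ (m ℕ.+ n) ≡ ℤ.+ m ℤ.* ℤ.+ 1 ℤ.+ ℤ.+ n ℤ.* ℤ.+ 1
    numerator = trans (ℤ.pos-+ m n)
      (sym (cong₂ ℤ._+_ (ℤ.*-identityʳ (ℤ.+ m)) (ℤ.*-identityʳ (ℤ.+ n))))

  ℕ→ℚ-* : ∀ m n → ℕ→ℚ (m ℕ.* n) ≡ ℕ→ℚ m * ℕ→ℚ n
  ℕ→ℚ-* m n = begin
    ℕ→ℚ (m ℕ.* n)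
      ≡⟨ /-cong {ℤ.+ (m ℕ.* n)} {1} {ℤ.+ m ℤ.* ℤ.+ n} {1} (ℤ.pos-* m n) refl ⟩
    ℕ→mkℚ m * ℕ→mkℚ n
      ≡⟨ sym (cong₂ _*_ (ℕ→ℚ≡ℕ→mkℚ m) (ℕ→ℚ≡ℕ→mkℚ n)) ⟩
    ℕ→ℚ m * ℕ→ℚ n ∎

  1/ℕ : (m : ℕ) → .{{NonZero m}} → ℚ
  1/ℕ m = ℤ.+ 1 / m

  ℕ→ℚ*1/ℕ≡1 : ∀ m .{{_ : NonZero m}} → ℕ→ℚ m * 1/ℕ m ≡ 1ℚ
  ℕ→ℚ*1/ℕ≡1 (suc m) = begin
    ℕ→ℚ (suc m) * 1/ℕ (suc m)
      ≡⟨ cong₂ _*_ (ℕ→ℚ≡ℕ→mkℚ (suc m)) (normalize-coprime (1-coprimeTo (suc m))) ⟩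
    ℕ→mkℚ (suc m) * mkℚ (ℤ.+ 1) m (1-coprimeTo (suc m))
      ≡⟨ *-inverseʳ (ℕ→mkℚ (suc m)) ⟩
    1ℚ ∎

  ℕ→ℚ-*-cancelˡ : ∀ m .{{_ : NonZero m}} {x y} → ℕ→ℚ m * x ≡ ℕ→ℚ m * y → x ≡ y
  ℕ→ℚ-*-cancelˡ m {x} {y} eq = begin
    x                          ≡⟨ divide x ⟩
    1/ℕ m * (ℕ→ℚ m * x)        ≡⟨ cong (1/ℕ m *_) eq ⟩
    1/ℕ m * (ℕ→ℚ m * y)        ≡⟨ divide y ⟨
    y                          ∎
    where
    divide : ∀ z → z ≡ 1/ℕ m * (ℕ→ℚ m * z)
    divide z = begin
      z                        ≡⟨ *-identityˡ z ⟨
      1ℚ * z                   ≡⟨ cong (_* z) (ℕ→ℚ*1/ℕ≡1 m) ⟨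
      ℕ→ℚ m * 1/ℕ m * z
        ≡⟨ solve 3 (λ a b z → a :* b :* z := b :* (a :* z)) refl (ℕ→ℚ m) (1/ℕ m) z ⟩
      1/ℕ m * (ℕ→ℚ m * z)      ∎

  1/ℕ-* : ∀ m n .{{_ : NonZero m}} .{{_ : NonZero n}} .{{_ : NonZero (m ℕ.* n)}} →
    1/ℕ (m ℕ.* n) ≡ 1/ℕ m * 1/ℕ n
  1/ℕ-* m n = ℕ→ℚ-*-cancelˡ (m ℕ.* n) (begin
    ℕ→ℚ (m ℕ.* n) * 1/ℕ (m ℕ.* n)      ≡⟨ ℕ→ℚ*1/ℕ≡1 (m ℕ.* n) ⟩
    1ℚ                                 ≡⟨ cong₂ _*_ (ℕ→ℚ*1/ℕ≡1 m) (ℕ→ℚ*1/ℕ≡1 n) ⟨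
    (ℕ→ℚ m * 1/ℕ m) * (ℕ→ℚ n * 1/ℕ n)
      ≡⟨ solve 4 (λ a b x y → (a :* x) :* (b :* y) := a :* b :* (x :* y)) refl
           (ℕ→ℚ m) (ℕ→ℚ n) (1/ℕ m) (1/ℕ n) ⟩
    ℕ→ℚ m * ℕ→ℚ n * (1/ℕ m * 1/ℕ n)    ≡⟨ cong (_* (1/ℕ m * 1/ℕ n)) (ℕ→ℚ-* m n) ⟨
    ℕ→ℚ (m ℕ.* n) * (1/ℕ m * 1/ℕ n)    ∎)

  x≡-x⇒x≡0 : ∀ {x} → x ≡ - x → x ≡ 0ℚ
  x≡-x⇒x≡0 {x} x≡-x = ℕ→ℚ-*-cancelˡ 2 (begin
    ℕ→ℚ 2 * x         ≡⟨ solve 1 (λ x → (con 1ℚ :+ con 1ℚ) :* x := x :+ x) refl x ⟩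
    x + x             ≡⟨ cong (x +_) x≡-x ⟩
    x - x             ≡⟨ +-inverseʳ x ⟩
    0ℚ                ≡⟨ *-zeroʳ (ℕ→ℚ 2) ⟨
    ℕ→ℚ 2 * 0ℚ        ∎)

  1/_! : ℕ → ℚ
  1/ n ! = 1/ℕ (n !) {{n !≢0}}

  suc*1/suc!≡1/! : ∀ n → ℕ→ℚ (suc n) * 1/ suc n ! ≡ 1/ n !
  suc*1/suc!≡1/! n = begin
    ℕ→ℚ (suc n) * 1/ suc n !
      ≡⟨ cong (ℕ→ℚ (suc n) *_) (1/ℕ-* (suc n) (n !) {{_}} {{n !≢0}} {{suc n !≢0}}) ⟩
    ℕ→ℚ (suc n) * (1/ℕ (suc n) * 1/ n !)     ≡⟨ *-assoc (ℕ→ℚ (suc n)) (1/ℕ (suc n)) (1/ n !) ⟨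
    (ℕ→ℚ (suc n) * 1/ℕ (suc n)) * 1/ n !     ≡⟨ cong (_* 1/ n !) (ℕ→ℚ*1/ℕ≡1 (suc n)) ⟩
    1ℚ * 1/ n !                               ≡⟨ *-identityˡ (1/ n !) ⟩
    1/ n !                                    ∎

  1/!*1/!≡C*1/! : ∀ {n k} → k ≤ n → 1/ k ! * 1/ (n ∸ k) ! ≡ ℕ→ℚ (n C k) * 1/ n !
  1/!*1/!≡C*1/! {n} {k} k≤n = ℕ→ℚ-*-cancelˡ (k ! ℕ.* (n ∸ k) !) {{k !* (n ∸ k) !≢0}} (begin
    ℕ→ℚ d * (1/ k ! * 1/ (n ∸ k) !)
      ≡⟨ cong (ℕ→ℚ d *_) (1/ℕ-* (k !) ((n ∸ k) !) {{k !≢0}} {{(n ∸ k) !≢0}} {{k !* (n ∸ k) !≢0}}) ⟨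
    ℕ→ℚ d * 1/ℕ d {{k !* (n ∸ k) !≢0}}    ≡⟨ ℕ→ℚ*1/ℕ≡1 d {{k !* (n ∸ k) !≢0}} ⟩
    1ℚ                                  ≡⟨ ℕ→ℚ*1/ℕ≡1 (n !) {{n !≢0}} ⟨
    ℕ→ℚ (n !) * 1/ n !                  ≡⟨ cong (λ m → ℕ→ℚ m * 1/ n !) d*nCk≡n! ⟨
    ℕ→ℚ (d ℕ.* (n C k)) * 1/ n !        ≡⟨ cong (_* 1/ n !) (ℕ→ℚ-* d (n C k)) ⟩
    ℕ→ℚ d * ℕ→ℚ (n C k) * 1/ n !        ≡⟨ *-assoc (ℕ→ℚ d) (ℕ→ℚ (n C k)) (1/ n !) ⟩
    ℕ→ℚ d * (ℕ→ℚ (n C k) * 1/ n !)      ∎)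
    where
    d : ℕ
    d = k ! ℕ.* (n ∸ k) !
    d*nCk≡n! : d ℕ.* (n C k) ≡ n !
    d*nCk≡n! = begin
      d ℕ.* (n C k)              ≡⟨ ℕ.*-comm d (n C k) ⟩
      (n C k) ℕ.* d              ≡⟨ cong (ℕ._* d) (nCk≡n!/k![n-k]! k≤n) ⟩
      ((n ! ℕ./ d) {{k !* (n ∸ k) !≢0}}) ℕ.* d
        ≡⟨ m/n*n≡m {{k !* (n ∸ k) !≢0}} (k![n∸k]!∣n! k≤n) ⟩
      n !                        ∎

  sumTo-cong : ∀ n {f g : ℕ → ℚ} → (∀ i → i ≤ n → f i ≡ g i) → sumTo n f ≡ sumTo n g
  sumTo-cong zero    f≗g = f≗g 0 z≤n
  sumTo-cong (suc n) f≗g =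
    cong₂ _+_ (sumTo-cong n (λ i i≤n → f≗g i (ℕ.m≤n⇒m≤1+n i≤n))) (f≗g (suc n) ℕ.≤-refl)

  sumTo-+ : ∀ n (f g : ℕ → ℚ) → sumTo n (λ i → f i + g i) ≡ sumTo n f + sumTo n g
  sumTo-+ zero    f g = refl
  sumTo-+ (suc n) f g = trans (cong (_+ (f (suc n) + g (suc n))) (sumTo-+ n f g))
    (solve 4 (λ a b c d → (a :+ b) :+ (c :+ d) := (a :+ c) :+ (b :+ d)) refl
      (sumTo n f) (sumTo n g) (f (suc n)) (g (suc n)))

  sumTo-*ˡ : ∀ n c (f : ℕ → ℚ) → sumTo n (λ i → c * f i) ≡ c * sumTo n f
  sumTo-*ˡ zero    c f = refl
  sumTo-*ˡ (suc n) c f = trans (cong (_+ (c * f (suc n))) (sumTo-*ˡ n c f))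
    (sym (*-distribˡ-+ c (sumTo n f) (f (suc n))))

  sumTo-*ʳ : ∀ n c (f : ℕ → ℚ) → sumTo n (λ i → f i * c) ≡ sumTo n f * c
  sumTo-*ʳ n c f = trans (sumTo-cong n (λ i _ → *-comm (f i) c))
    (trans (sumTo-*ˡ n c f) (*-comm c (sumTo n f)))

  sumTo-neg : ∀ n (f : ℕ → ℚ) → sumTo n (λ i → - f i) ≡ - sumTo n f
  sumTo-neg zero    f = refl
  sumTo-neg (suc n) f = trans (cong (_+ (- f (suc n))) (sumTo-neg n f))
    (sym (neg-distrib-+ (sumTo n f) (f (suc n))))

  sumTo-0 : ∀ n → sumTo n (λ _ → 0ℚ) ≡ 0ℚ
  sumTo-0 zero    = refl
  sumTo-0 (suc n) = cong (_+ 0ℚ) (sumTo-0 n)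

  sumTo-suc : ∀ n (f : ℕ → ℚ) → sumTo (suc n) f ≡ f 0 + sumTo n (λ i → f (suc i))
  sumTo-suc zero    f = refl
  sumTo-suc (suc n) f = trans (cong (_+ f (suc (suc n))) (sumTo-suc n f))
    (+-assoc (f 0) (sumTo n (λ i → f (suc i))) (f (suc (suc n))))

  sumTo-reverse : ∀ n (f : ℕ → ℚ) → sumTo n f ≡ sumTo n (λ i → f (n ∸ i))
  sumTo-reverse zero    f = refl
  sumTo-reverse (suc n) f = begin
    sumTo n f + f (suc n)                     ≡⟨ cong (_+ f (suc n)) (sumTo-reverse n f) ⟩
    sumTo n (λ i → f (n ∸ i)) + f (suc n)     ≡⟨ +-comm _ (f (suc n)) ⟩
    f (suc n) + sumTo n (λ i → f (n ∸ i))     ≡⟨ sumTo-suc n (λ i → f (suc n ∸ i)) ⟨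
    sumTo (suc n) (λ i → f (suc n ∸ i))       ∎

  sumTo-triangle : ∀ n (A : ℕ → ℕ → ℚ) →
    sumTo n (λ i → sumTo i (λ j → A j i)) ≡ sumTo n (λ j → sumTo (n ∸ j) (λ k → A j (j ℕ.+ k)))
  sumTo-triangle zero    A = refl
  sumTo-triangle (suc n) A = begin
    sumTo n (λ i → sumTo i (λ j → A j i)) + (sumTo n (λ j → A j (suc n)) + A (suc n) (suc n))
      ≡⟨ cong (_+ sumTo (suc n) (λ j → A j (suc n))) (sumTo-triangle n A) ⟩
    rows n + (sumTo n (λ j → A j (suc n)) + A (suc n) (suc n))
      ≡⟨ +-assoc (rows n) _ _ ⟨
    (rows n + sumTo n (λ j → A j (suc n))) + A (suc n) (suc n)
      ≡⟨ cong (_+ A (suc n) (suc n)) (sumTo-+ n _ _) ⟨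
    sumTo n (λ j → row n j + A j (suc n)) + A (suc n) (suc n)
      ≡⟨ cong₂ _+_ (sumTo-cong n extend-row) (cong (A (suc n)) (ℕ.+-identityʳ (suc n))) ⟨
    sumTo n (row (suc n)) + A (suc n) (suc n ℕ.+ 0)
      ≡⟨ cong (λ m → sumTo n (row (suc n)) + sumTo m (λ k → A (suc n) (suc n ℕ.+ k))) (ℕ.n∸n≡0 n) ⟨
    sumTo n (row (suc n)) + row (suc n) (suc n) ∎
    where
    row : ℕ → ℕ → ℚ
    row m j = sumTo (m ∸ j) (λ k → A j (j ℕ.+ k))
    rows : ℕ → ℚ
    rows m = sumTo m (row m)
    extend-row : ∀ j → j ≤ n → row (suc n) j ≡ row n j + A j (suc n)
    extend-row j j≤n = begin
      row (suc n) j
        ≡⟨ cong (λ m → sumTo m (λ k → A j (j ℕ.+ k))) (ℕ.+-∸-assoc 1 j≤n) ⟩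
      sumTo (suc (n ∸ j)) (λ k → A j (j ℕ.+ k))
        ≡⟨ cong (λ m → row n j + A j m) (trans (ℕ.+-suc j (n ∸ j)) (cong suc (ℕ.m+[n∸m]≡n j≤n))) ⟩
      row n j + A j (suc n) ∎

  -- A series is its sequence of coefficients: shift f is t·f, θ f is t·f′, and alt f is f(−t).
  Series : Set
  Series = ℕ → ℚ

  infixl 7 _⋆_
  infixl 6 _⊕_
  infix 8 ⊖_

  _⋆_ : Series → Series → Series
  (f ⋆ g) n = sumTo n (λ i → f i * g (n ∸ i))

  _⊕_ : Series → Series → Series
  (f ⊕ g) n = f n + g n

  ⊖_ : Series → Series
  (⊖ f) n = - f n

  𝟘 : Series
  𝟘 _ = 0ℚ

  𝟙 : Series
  𝟙 zero    = 1ℚ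
  𝟙 (suc _) = 0ℚ

  shift : Series → Series
  shift f zero    = 0ℚ
  shift f (suc n) = f n

  shift-cong : ∀ {f g} → f ≗ g → shift f ≗ shift g
  shift-cong f≗g zero    = refl
  shift-cong f≗g (suc n) = f≗g n

  θ : Series → Series
  θ f n = ℕ→ℚ n * f n

  sign : ℕ → ℚ
  sign zero    = 1ℚ
  sign (suc n) = - sign n

  alt : Series → Series
  alt f n = sign n * f n

  sign-+ : ∀ m n → sign (m ℕ.+ n) ≡ sign m * sign n
  sign-+ zero    n = sym (*-identityˡ (sign n))
  sign-+ (suc m) n = trans (cong -_ (sign-+ m n)) (neg-distribˡ-* (sign m) (sign n))

  sign-even : ∀ k → sign (2 ℕ.* k) ≡ 1ℚ
  sign-even zero    = refl
  sign-even (suc k) = begin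
    sign (2 ℕ.* suc k)       ≡⟨ cong sign (ℕ.*-suc 2 k) ⟩
    - - sign (2 ℕ.* k)       ≡⟨ solve 1 (λ s → :- (:- s) := s) refl (sign (2 ℕ.* k)) ⟩
    sign (2 ℕ.* k)           ≡⟨ sign-even k ⟩
    1ℚ                       ∎

  ⋆-congˡ : ∀ f {g g′} → g ≗ g′ → f ⋆ g ≗ f ⋆ g′
  ⋆-congˡ f g≗g′ n = sumTo-cong n (λ i _ → cong (f i *_) (g≗g′ (n ∸ i)))

  ⋆-congʳ : ∀ g {f f′} → f ≗ f′ → f ⋆ g ≗ f′ ⋆ g
  ⋆-congʳ g f≗f′ n = sumTo-cong n (λ i _ → cong (_* g (n ∸ i)) (f≗f′ i))

  ⋆-comm : ∀ f g → f ⋆ g ≗ g ⋆ f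
  ⋆-comm f g n = trans (sumTo-reverse n (λ i → f i * g (n ∸ i))) (sumTo-cong n λ i i≤n →
    trans (cong (λ j → f (n ∸ i) * g j) (ℕ.m∸[m∸n]≡n i≤n)) (*-comm (f (n ∸ i)) (g i)))

  ⋆-assoc : ∀ f g h → (f ⋆ g) ⋆ h ≗ f ⋆ (g ⋆ h)
  ⋆-assoc f g h n = begin
    sumTo n (λ i → sumTo i (λ j → f j * g (i ∸ j)) * h (n ∸ i))
      ≡⟨ sumTo-cong n (λ i _ → sumTo-*ʳ i (h (n ∸ i)) _) ⟨
    sumTo n (λ i → sumTo i (λ j → f j * g (i ∸ j) * h (n ∸ i)))
      ≡⟨ sumTo-triangle n (λ j i → f j * g (i ∸ j) * h (n ∸ i)) ⟩
    sumTo n (λ j → sumTo (n ∸ j) (λ k → f j * g (j ℕ.+ k ∸ j) * h (n ∸ (j ℕ.+ k))))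
      ≡⟨ sumTo-cong n (λ j _ →
           trans (sumTo-cong (n ∸ j) (λ k _ → reindex j k)) (sumTo-*ˡ (n ∸ j) (f j) _)) ⟩
    sumTo n (λ j → f j * sumTo (n ∸ j) (λ k → g k * h (n ∸ j ∸ k))) ∎
    where
    reindex : ∀ j k → f j * g (j ℕ.+ k ∸ j) * h (n ∸ (j ℕ.+ k)) ≡ f j * (g k * h (n ∸ j ∸ k))
    reindex j k = trans (cong₂ (λ a b → f j * g a * h b) (ℕ.m+n∸m≡n j k) (sym (ℕ.∸-+-assoc n j k)))
      (*-assoc (f j) (g k) (h (n ∸ j ∸ k)))

  ⋆-distribˡ : ∀ f g h → f ⋆ (g ⊕ h) ≗ f ⋆ g ⊕ f ⋆ h
  ⋆-distribˡ f g h n = trans (sumTo-cong n (λ i _ → *-distribˡ-+ (f i) (g (n ∸ i)) (h (n ∸ i))))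
    (sumTo-+ n (λ i → f i * g (n ∸ i)) (λ i → f i * h (n ∸ i)))

  ⋆-distribʳ : ∀ f g h → (g ⊕ h) ⋆ f ≗ g ⋆ f ⊕ h ⋆ f
  ⋆-distribʳ f g h n = trans (⋆-comm (g ⊕ h) f n) (trans (⋆-distribˡ f g h n)
    (cong₂ _+_ (⋆-comm f g n) (⋆-comm f h n)))

  ⋆-negʳ : ∀ f g → f ⋆ ⊖ g ≗ ⊖ (f ⋆ g)
  ⋆-negʳ f g n = trans (sumTo-cong n (λ i _ → sym (neg-distribʳ-* (f i) (g (n ∸ i)))))
    (sumTo-neg n (λ i → f i * g (n ∸ i)))

  ⋆-negˡ : ∀ f g → ⊖ f ⋆ g ≗ ⊖ (f ⋆ g)
  ⋆-negˡ f g n = trans (⋆-comm (⊖ f) g n) (trans (⋆-negʳ g f n) (cong -_ (⋆-comm g f n)))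

  ⋆-identityˡ : ∀ f → 𝟙 ⋆ f ≗ f
  ⋆-identityˡ f zero    = *-identityˡ (f 0)
  ⋆-identityˡ f (suc n) = begin
    sumTo (suc n) (λ i → 𝟙 i * f (suc n ∸ i))               ≡⟨ sumTo-suc n _ ⟩
    1ℚ * f (suc n) + sumTo n (λ i → 0ℚ * f (n ∸ i))
      ≡⟨ cong₂ _+_ (*-identityˡ (f (suc n)))
                   (trans (sumTo-cong n (λ i _ → *-zeroˡ (f (n ∸ i)))) (sumTo-0 n)) ⟩
    f (suc n) + 0ℚ                                         ≡⟨ +-identityʳ (f (suc n)) ⟩
    f (suc n)                                              ∎

  ⋆-identityʳ : ∀ f → f ⋆ 𝟙 ≗ f
  ⋆-identityʳ f n = trans (⋆-comm f 𝟙 n) (⋆-identityˡ f n)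

  shift-⋆ : ∀ f g → shift f ⋆ g ≗ shift (f ⋆ g)
  shift-⋆ f g zero    = *-zeroˡ (g 0)
  shift-⋆ f g (suc n) = trans (sumTo-suc n (λ i → shift f i * g (suc n ∸ i)))
    (trans (cong (_+ (f ⋆ g) n) (*-zeroˡ (g (suc n)))) (+-identityˡ ((f ⋆ g) n)))

  ⋆-shift : ∀ f g → f ⋆ shift g ≗ shift (f ⋆ g)
  ⋆-shift f g n = trans (⋆-comm f (shift g) n) (trans (shift-⋆ g f n) (shift-cong (⋆-comm g f) n))

  θ-⋆ : ∀ f g → θ (f ⋆ g) ≗ θ f ⋆ g ⊕ f ⋆ θ g
  θ-⋆ f g n = begin
    ℕ→ℚ n * sumTo n (λ i → f i * g (n ∸ i))                  ≡⟨ sumTo-*ˡ n (ℕ→ℚ n) _ ⟨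
    sumTo n (λ i → ℕ→ℚ n * (f i * g (n ∸ i)))                ≡⟨ sumTo-cong n leibniz ⟩
    sumTo n (λ i → θ f i * g (n ∸ i) + f i * θ g (n ∸ i))    ≡⟨ sumTo-+ n _ _ ⟩
    (θ f ⋆ g ⊕ f ⋆ θ g) n                                    ∎
    where
    leibniz : ∀ i → i ≤ n → ℕ→ℚ n * (f i * g (n ∸ i)) ≡ θ f i * g (n ∸ i) + f i * θ g (n ∸ i)
    leibniz i i≤n = begin
      ℕ→ℚ n * (f i * g (n ∸ i))
        ≡⟨ cong (λ m → ℕ→ℚ m * (f i * g (n ∸ i))) (ℕ.m+[n∸m]≡n i≤n) ⟨
      ℕ→ℚ (i ℕ.+ (n ∸ i)) * (f i * g (n ∸ i))
        ≡⟨ cong (_* (f i * g (n ∸ i))) (ℕ→ℚ-+ i (n ∸ i)) ⟩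
      (ℕ→ℚ i + ℕ→ℚ (n ∸ i)) * (f i * g (n ∸ i))
        ≡⟨ solve 4 (λ a b x y → (a :+ b) :* (x :* y) := a :* x :* y :+ x :* (b :* y)) refl
             (ℕ→ℚ i) (ℕ→ℚ (n ∸ i)) (f i) (g (n ∸ i)) ⟩
      θ f i * g (n ∸ i) + f i * θ g (n ∸ i) ∎

  alt-⋆ : ∀ f g → alt (f ⋆ g) ≗ alt f ⋆ alt g
  alt-⋆ f g n = begin
    sign n * sumTo n (λ i → f i * g (n ∸ i))                 ≡⟨ sumTo-*ˡ n (sign n) _ ⟨
    sumTo n (λ i → sign n * (f i * g (n ∸ i)))               ≡⟨ sumTo-cong n split-sign ⟩
    sumTo n (λ i → alt f i * alt g (n ∸ i))                  ∎
    where
    split-sign : ∀ i → i ≤ n → sign n * (f i * g (n ∸ i)) ≡ alt f i * alt g (n ∸ i)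
    split-sign i i≤n = begin
      sign n * (f i * g (n ∸ i))
        ≡⟨ cong (λ m → sign m * (f i * g (n ∸ i))) (ℕ.m+[n∸m]≡n i≤n) ⟨
      sign (i ℕ.+ (n ∸ i)) * (f i * g (n ∸ i))
        ≡⟨ cong (_* (f i * g (n ∸ i))) (sign-+ i (n ∸ i)) ⟩
      sign i * sign (n ∸ i) * (f i * g (n ∸ i))
        ≡⟨ solve 4 (λ a b x y → a :* b :* (x :* y) := a :* x :* (b :* y)) refl
             (sign i) (sign (n ∸ i)) (f i) (g (n ∸ i)) ⟩
      alt f i * alt g (n ∸ i) ∎

  alt-shift : ∀ f → alt (shift f) ≗ ⊖ shift (alt f)
  alt-shift f zero    = refl
  alt-shift f (suc n) = sym (neg-distribˡ-* (sign n) (f n))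

  θ-alt : ∀ f → θ (alt f) ≗ alt (θ f)
  θ-alt f n = solve 3 (λ a s x → a :* (s :* x) := s :* (a :* x)) refl (ℕ→ℚ n) (sign n) (f n)

  alt-𝟙 : alt 𝟙 ≗ 𝟙
  alt-𝟙 zero    = refl
  alt-𝟙 (suc n) = *-zeroʳ (sign (suc n))

  θ-𝟙 : θ 𝟙 ≗ 𝟘
  θ-𝟙 zero    = refl
  θ-𝟙 (suc n) = *-zeroʳ (ℕ→ℚ (suc n))

  θ≗𝟘⇒f[1+n]≡0 : ∀ {f} → θ f ≗ 𝟘 → ∀ n → f (suc n) ≡ 0ℚ
  θ≗𝟘⇒f[1+n]≡0 θf≗𝟘 n =
    ℕ→ℚ-*-cancelˡ (suc n) (trans (θf≗𝟘 (suc n)) (sym (*-zeroʳ (ℕ→ℚ (suc n)))))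

  -- Strong induction: the only new term in (f ⋆ g) (1 + n) is f (1 + n) * g 0.
  ⋆-cancelʳ : ∀ {f h g} → g 0 ≡ 1ℚ → f ⋆ g ≗ h ⋆ g → f ≗ h
  ⋆-cancelʳ {f} {h} {g} g₀≡1 eq n = agree n n ℕ.≤-refl
    where
    cancel-g₀ : ∀ {x y m} → m ≡ 0 → x * g m ≡ y * g m → x ≡ y
    cancel-g₀ {x} {y} refl x*g₀≡y*g₀ = begin
      x              ≡⟨ *-identityʳ x ⟨
      x * 1ℚ         ≡⟨ cong (x *_) g₀≡1 ⟨
      x * g 0        ≡⟨ x*g₀≡y*g₀ ⟩
      y * g 0        ≡⟨ cong (y *_) g₀≡1 ⟩
      y * 1ℚ         ≡⟨ *-identityʳ y ⟩
      y              ∎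
    agree : ∀ n i → i ≤ n → f i ≡ h i
    agree zero    zero    _ = cancel-g₀ refl (eq 0)
    agree (suc n) i i≤1+n with ℕ.m≤n⇒m<n∨m≡n i≤1+n
    ... | inj₁ (s≤s i≤n) = agree n i i≤n
    ... | inj₂ refl      = cancel-g₀ (ℕ.n∸n≡0 n) (+-cancelˡ (lower h) _ _ (begin
      lower h + f (suc n) * g (n ∸ n)
        ≡⟨ cong (_+ f (suc n) * g (n ∸ n)) (sumTo-cong n (λ i i≤n → cong (_* _) (agree n i i≤n))) ⟨
      lower f + f (suc n) * g (n ∸ n)
        ≡⟨ eq (suc n) ⟩
      lower h + h (suc n) * g (n ∸ n) ∎))
      where
      lower : Series → ℚ
      lower k = sumTo n (λ i → k i * g (suc n ∸ i))

  -- exp k = (eᵗ − Σ_{j<k} tʲ/j!)/tᵏ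
  exp : ℕ → Series
  exp k n = 1/ (k ℕ.+ n) !

  exp₀≗𝟙⊕shift-exp₁ : exp 0 ≗ 𝟙 ⊕ shift (exp 1)
  exp₀≗𝟙⊕shift-exp₁ zero    = refl
  exp₀≗𝟙⊕shift-exp₁ (suc n) = sym (+-identityˡ (exp 1 n))

  exp₁≗𝟙⊕shift-exp₂ : exp 1 ≗ 𝟙 ⊕ shift (exp 2)
  exp₁≗𝟙⊕shift-exp₂ zero    = refl
  exp₁≗𝟙⊕shift-exp₂ (suc n) = sym (+-identityˡ (exp 2 n))

  θ-exp₀ : θ (exp 0) ≗ shift (exp 0)
  θ-exp₀ zero    = refl
  θ-exp₀ (suc n) = suc*1/suc!≡1/! n

  θ-exp₁ : θ (exp 1) ⊕ exp 1 ≗ exp 0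
  θ-exp₁ n = begin
    ℕ→ℚ n * 1/ suc n ! + 1/ suc n !
      ≡⟨ solve 2 (λ a e → a :* e :+ e := (con 1ℚ :+ a) :* e) refl (ℕ→ℚ n) (1/ suc n !) ⟩
    (1ℚ + ℕ→ℚ n) * 1/ suc n !           ≡⟨ cong (_* 1/ suc n !) (ℕ→ℚ-+ 1 n) ⟨
    ℕ→ℚ (suc n) * 1/ suc n !            ≡⟨ suc*1/suc!≡1/! n ⟩
    1/ n !                              ∎

  alt-exp₀⋆exp₀ : alt (exp 0) ⋆ exp 0 ≗ 𝟙
  alt-exp₀⋆exp₀ zero    = refl
  alt-exp₀⋆exp₀ (suc n) = θ≗𝟘⇒f[1+n]≡0 θ-product≗𝟘 n
    where
    θ-alt-exp₀ : θ (alt (exp 0)) ≗ ⊖ shift (alt (exp 0))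
    θ-alt-exp₀ j = trans (θ-alt (exp 0) j) (trans (cong (sign j *_) (θ-exp₀ j)) (alt-shift (exp 0) j))
    θ-product≗𝟘 : θ (alt (exp 0) ⋆ exp 0) ≗ 𝟘
    θ-product≗𝟘 k = begin
      θ (alt (exp 0) ⋆ exp 0) k
        ≡⟨ θ-⋆ (alt (exp 0)) (exp 0) k ⟩
      (θ (alt (exp 0)) ⋆ exp 0) k + (alt (exp 0) ⋆ θ (exp 0)) k
        ≡⟨ cong₂ _+_ (⋆-congʳ (exp 0) θ-alt-exp₀ k) (⋆-congˡ (alt (exp 0)) θ-exp₀ k) ⟩
      (⊖ shift (alt (exp 0)) ⋆ exp 0) k + (alt (exp 0) ⋆ shift (exp 0)) k
        ≡⟨ cong₂ _+_
             (trans (⋆-negˡ (shift (alt (exp 0))) (exp 0) k) (cong -_ (shift-⋆ (alt (exp 0)) (exp 0) k)))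
             (⋆-shift (alt (exp 0)) (exp 0) k) ⟩
      - shift (alt (exp 0) ⋆ exp 0) k + shift (alt (exp 0) ⋆ exp 0) k
        ≡⟨ +-inverseˡ (shift (alt (exp 0) ⋆ exp 0) k) ⟩
      0ℚ ∎

  alt-exp₁⋆exp₀ : alt (exp 1) ⋆ exp 0 ≗ exp 1
  alt-exp₁⋆exp₀ n = begin
    (alt (exp 1) ⋆ exp 0) n                   ≡⟨ shift-⋆ (alt (exp 1)) (exp 0) (suc n) ⟨
    (shift (alt (exp 1)) ⋆ exp 0) (suc n)     ≡⟨ ⋆-congʳ (exp 0) shift-alt-exp₁ (suc n) ⟩
    ((𝟙 ⊕ ⊖ alt (exp 0)) ⋆ exp 0) (suc n)     ≡⟨ ⋆-distribʳ (exp 0) 𝟙 (⊖ alt (exp 0)) (suc n) ⟩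
    (𝟙 ⋆ exp 0) (suc n) + (⊖ alt (exp 0) ⋆ exp 0) (suc n)
      ≡⟨ cong₂ _+_ (⋆-identityˡ (exp 0) (suc n))
                   (trans (⋆-negˡ (alt (exp 0)) (exp 0) (suc n)) (cong -_ (alt-exp₀⋆exp₀ (suc n)))) ⟩
    exp 1 n + - 0ℚ                            ≡⟨ +-identityʳ (exp 1 n) ⟩
    exp 1 n                                   ∎
    where
    shift-alt-exp₁ : shift (alt (exp 1)) ≗ 𝟙 ⊕ ⊖ alt (exp 0)
    shift-alt-exp₁ zero    = refl
    shift-alt-exp₁ (suc k) = solve 2 (λ s e → s :* e := con 0ℚ :+ (:- ((:- s) :* e))) refl (sign k) (exp 1 k)

  -- Defs computes B n as the last element of bernList n with a function local to B; the
  -- underscore below is that function applied to ys, which cannot be named here.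
  last-∷ʳ : (last : List ℚ → ℚ) → (∀ x → last [ x ] ≡ x) →
    (∀ x y ys → last (x ∷ y ∷ ys) ≡ last (y ∷ ys)) → ∀ ys {xs x} → ys ≡ xs ∷ʳ x → last ys ≡ x
  last-∷ʳ last last-[x] last-∷∷ _ {[]}         {x} refl = last-[x] x
  last-∷ʳ last last-[x] last-∷∷ _ {y ∷ []}     {x} refl = trans (last-∷∷ y x []) (last-[x] x)
  last-∷ʳ last last-[x] last-∷∷ _ {y ∷ z ∷ zs} {x} refl =
    trans (last-∷∷ y z (zs ∷ʳ x)) (last-∷ʳ last last-[x] last-∷∷ _ {z ∷ zs} refl)

  mutual
    B-last-∷ʳ : ∀ m ys {xs x} → ys ≡ xs ∷ʳ x → _ ≡ x
    B-last-∷ʳ m = last-∷ʳ _ (λ _ → refl) (λ _ _ _ → refl)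

    B-suc : ∀ m → B (suc m) ≡ nextB (suc m) (bernList m)
    B-suc m with bernList (suc m) in eq
    ... | ys = B-last-∷ʳ m ys (sym eq)

  bernList≡applyUpTo : ∀ m → bernList m ≡ applyUpTo B (suc m)
  bernList≡applyUpTo zero    = refl
  bernList≡applyUpTo (suc m) = begin
    bernList m ∷ʳ nextB (suc m) (bernList m)   ≡⟨ cong₂ _∷ʳ_ (bernList≡applyUpTo m) (sym (B-suc m)) ⟩
    applyUpTo B (suc m) ∷ʳ B (suc m)           ≡⟨ applyUpTo-∷ʳ B (suc m) ⟩
    applyUpTo B (suc (suc m))                  ∎

  zipWith-applyUpTo : ∀ {A C : Set} (g : A → C → ℚ) (f : ℕ → A) (h : ℕ → C) n →
    zipWith g (applyUpTo f n) (applyUpTo h n) ≡ applyUpTo (λ k → g (f k) (h k)) n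
  zipWith-applyUpTo g f h zero    = refl
  zipWith-applyUpTo g f h (suc n) = cong (g (f 0) (h 0) ∷_) (zipWith-applyUpTo g (f ∘ suc) (h ∘ suc) n)

  foldr-+-applyUpTo : ∀ m (f : ℕ → ℚ) → foldr _+_ 0ℚ (applyUpTo f (suc m)) ≡ sumTo m f
  foldr-+-applyUpTo zero    f = +-identityʳ (f 0)
  foldr-+-applyUpTo (suc m) f = trans (cong (f 0 +_) (foldr-+-applyUpTo m (f ∘ suc))) (sym (sumTo-suc m f))

  B-suc≡sumTo : ∀ m → B (suc m) ≡ - (1/ℕ (suc (suc m)) * sumTo m (λ k → ℕ→ℚ (suc (suc m) C k) * B k))
  B-suc≡sumTo m = begin
    B (suc m)                                           ≡⟨ B-suc m ⟩
    - (1/ℕ M * foldr _+_ 0ℚ (zipWith g (upTo (suc m)) (bernList m)))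
      ≡⟨ cong (λ bs → - (1/ℕ M * foldr _+_ 0ℚ (zipWith g (upTo (suc m)) bs))) (bernList≡applyUpTo m) ⟩
    - (1/ℕ M * foldr _+_ 0ℚ (zipWith g (upTo (suc m)) (applyUpTo B (suc m))))
      ≡⟨ cong (λ bs → - (1/ℕ M * foldr _+_ 0ℚ bs)) (zipWith-applyUpTo g id B (suc m)) ⟩
    - (1/ℕ M * foldr _+_ 0ℚ (applyUpTo (λ k → g k (B k)) (suc m)))
      ≡⟨ cong (λ s → - (1/ℕ M * s)) (foldr-+-applyUpTo m (λ k → g k (B k))) ⟩
    - (1/ℕ M * sumTo m (λ k → g k (B k)))               ∎
    where
    M : ℕ
    M = suc (suc m)
    g : ℕ → ℚ → ℚ
    g k b = ℕ→ℚ (M C k) * b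

  bernoulli-recurrence : ∀ m → sumTo (suc m) (λ k → ℕ→ℚ (suc (suc m) C k) * B k) ≡ 0ℚ
  bernoulli-recurrence m = begin
    Σ + ℕ→ℚ (M C suc m) * B (suc m)        ≡⟨ cong (λ c → Σ + ℕ→ℚ c * B (suc m)) MC[M∸1]≡M ⟩
    Σ + ℕ→ℚ M * B (suc m)                  ≡⟨ cong (λ b → Σ + ℕ→ℚ M * b) (B-suc≡sumTo m) ⟩
    Σ + ℕ→ℚ M * - (1/ℕ M * Σ)
      ≡⟨ solve 3 (λ s a b → s :+ a :* (:- (b :* s)) := s :- a :* b :* s) refl Σ (ℕ→ℚ M) (1/ℕ M) ⟩
    Σ - ℕ→ℚ M * 1/ℕ M * Σ                  ≡⟨ cong (λ c → Σ - c * Σ) (ℕ→ℚ*1/ℕ≡1 M) ⟩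
    Σ - 1ℚ * Σ                             ≡⟨ solve 1 (λ s → s :- con 1ℚ :* s := con 0ℚ) refl Σ ⟩
    0ℚ                                     ∎
    where
    M : ℕ
    M = suc (suc m)
    Σ : ℚ
    Σ = sumTo m (λ k → ℕ→ℚ (M C k) * B k)
    MC[M∸1]≡M : M C suc m ≡ M
    MC[M∸1]≡M = begin
      M C suc m          ≡⟨ nCk≡nC[n∸k] (ℕ.n≤1+n (suc m)) ⟩
      M C (M ∸ suc m)    ≡⟨ cong (M C_) (ℕ.m+n∸n≡m 1 (suc m)) ⟩
      M C 1              ≡⟨ nC1≡n M ⟩
      M                  ∎

  -- bern = t/(eᵗ − 1)
  bern : Series
  bern n = B n * 1/ n !

  bern⋆exp₁ : bern ⋆ exp 1 ≗ 𝟙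
  bern⋆exp₁ zero    = refl
  bern⋆exp₁ (suc m) = begin
    sumTo (suc m) (λ k → B k * 1/ k ! * 1/ (1 ℕ.+ (suc m ∸ k)) !)
      ≡⟨ sumTo-cong (suc m) binomial ⟩
    sumTo (suc m) (λ k → ℕ→ℚ (M C k) * B k * 1/ M !)
      ≡⟨ sumTo-*ʳ (suc m) (1/ M !) (λ k → ℕ→ℚ (M C k) * B k) ⟩
    sumTo (suc m) (λ k → ℕ→ℚ (M C k) * B k) * 1/ M !
      ≡⟨ cong (_* 1/ M !) (bernoulli-recurrence m) ⟩
    0ℚ * 1/ M !                                        ≡⟨ *-zeroˡ (1/ M !) ⟩
    0ℚ                                                 ∎
    where
    M : ℕ
    M = suc (suc m)
    binomial : ∀ k → k ≤ suc m → B k * 1/ k ! * 1/ (1 ℕ.+ (suc m ∸ k)) ! ≡ ℕ→ℚ (M C k) * B k * 1/ M !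
    binomial k k≤1+m = begin
      B k * 1/ k ! * 1/ (1 ℕ.+ (suc m ∸ k)) !
        ≡⟨ cong (λ j → B k * 1/ k ! * 1/ j !) (ℕ.+-∸-assoc 1 k≤1+m) ⟨
      B k * 1/ k ! * 1/ (M ∸ k) !                ≡⟨ *-assoc (B k) (1/ k !) (1/ (M ∸ k) !) ⟩
      B k * (1/ k ! * 1/ (M ∸ k) !)              ≡⟨ cong (B k *_) (1/!*1/!≡C*1/! (ℕ.m≤n⇒m≤1+n k≤1+m)) ⟩
      B k * (ℕ→ℚ (M C k) * 1/ M !)
        ≡⟨ solve 3 (λ b c e → b :* (c :* e) := c :* b :* e) refl (B k) (ℕ→ℚ (M C k)) (1/ M !) ⟩
      ℕ→ℚ (M C k) * B k * 1/ M !                 ∎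

  bern⋆exp₀ : bern ⋆ exp 0 ≗ shift 𝟙 ⊕ bern
  bern⋆exp₀ n = begin
    (bern ⋆ exp 0) n                             ≡⟨ ⋆-congˡ bern exp₀≗𝟙⊕shift-exp₁ n ⟩
    (bern ⋆ (𝟙 ⊕ shift (exp 1))) n               ≡⟨ ⋆-distribˡ bern 𝟙 (shift (exp 1)) n ⟩
    (bern ⋆ 𝟙) n + (bern ⋆ shift (exp 1)) n
      ≡⟨ cong₂ _+_ (⋆-identityʳ bern n) (trans (⋆-shift bern (exp 1) n) (shift-cong bern⋆exp₁ n)) ⟩
    bern n + shift 𝟙 n                           ≡⟨ +-comm (bern n) (shift 𝟙 n) ⟩
    shift 𝟙 n + bern n                           ∎

  θbern⋆exp₁ : θ bern ⋆ exp 1 ≗ ⊖ (bern ⋆ θ (exp 1))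
  θbern⋆exp₁ n = inverseˡ-unique _ _ (begin
    (θ bern ⋆ exp 1) n + (bern ⋆ θ (exp 1)) n    ≡⟨ θ-⋆ bern (exp 1) n ⟨
    θ (bern ⋆ exp 1) n                           ≡⟨ cong (ℕ→ℚ n *_) (bern⋆exp₁ n) ⟩
    θ 𝟙 n                                        ≡⟨ θ-𝟙 n ⟩
    0ℚ                                           ∎)

  bern⋆θexp₁ : bern ⋆ θ (exp 1) ≗ shift 𝟙 ⊕ bern ⊕ ⊖ 𝟙
  bern⋆θexp₁ n = x≈z//y _ _ _ (begin
    (bern ⋆ θ (exp 1)) n + 𝟙 n                    ≡⟨ cong ((bern ⋆ θ (exp 1)) n +_) (bern⋆exp₁ n) ⟨
    (bern ⋆ θ (exp 1)) n + (bern ⋆ exp 1) n       ≡⟨ ⋆-distribˡ bern (θ (exp 1)) (exp 1) n ⟨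
    (bern ⋆ (θ (exp 1) ⊕ exp 1)) n                ≡⟨ ⋆-congˡ bern θ-exp₁ n ⟩
    (bern ⋆ exp 0) n                              ≡⟨ bern⋆exp₀ n ⟩
    shift 𝟙 n + bern n                            ∎)

  shift-⋆exp₂ : ∀ f → shift (f ⋆ exp 2) ≗ f ⋆ exp 1 ⊕ ⊖ f
  shift-⋆exp₂ f n = x≈z//y _ _ _ (begin
    shift (f ⋆ exp 2) n + f n                     ≡⟨ +-comm (shift (f ⋆ exp 2) n) (f n) ⟩
    f n + shift (f ⋆ exp 2) n                     ≡⟨ cong₂ _+_ (⋆-identityʳ f n) (⋆-shift f (exp 2) n) ⟨
    (f ⋆ 𝟙) n + (f ⋆ shift (exp 2)) n             ≡⟨ ⋆-distribˡ f 𝟙 (shift (exp 2)) n ⟨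
    (f ⋆ (𝟙 ⊕ shift (exp 2))) n                   ≡⟨ ⋆-congˡ f exp₁≗𝟙⊕shift-exp₂ n ⟨
    (f ⋆ exp 1) n                                 ∎)

  shift-θbern⊖bern⋆exp₂ : shift ((θ bern ⊕ ⊖ bern) ⋆ exp 2) ≗ ⊖ shift 𝟙 ⊕ ⊖ θ bern
  shift-θbern⊖bern⋆exp₂ n = begin
    shift ((θ bern ⊕ ⊖ bern) ⋆ exp 2) n
      ≡⟨ shift-⋆exp₂ (θ bern ⊕ ⊖ bern) n ⟩
    ((θ bern ⊕ ⊖ bern) ⋆ exp 1) n - (θ bern n - bern n)
      ≡⟨ cong (_- (θ bern n - bern n))
           (trans (⋆-distribʳ (exp 1) (θ bern) (⊖ bern) n)
                  (cong ((θ bern ⋆ exp 1) n +_) (⋆-negˡ bern (exp 1) n))) ⟩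
    ((θ bern ⋆ exp 1) n - (bern ⋆ exp 1) n) - (θ bern n - bern n)
      ≡⟨ cong₂ (λ u v → (u - v) - (θ bern n - bern n)) (θbern⋆exp₁ n) (bern⋆exp₁ n) ⟩
    (- (bern ⋆ θ (exp 1)) n - 𝟙 n) - (θ bern n - bern n)
      ≡⟨ cong (λ u → (- u - 𝟙 n) - (θ bern n - bern n)) (bern⋆θexp₁ n) ⟩
    (- (shift 𝟙 n + bern n - 𝟙 n) - 𝟙 n) - (θ bern n - bern n)
      ≡⟨ solve 4 (λ t b o d → (:- (t :+ b :- o) :- o) :- (d :- b) := :- t :- d) refl
           (shift 𝟙 n) (bern n) (𝟙 n) (θ bern n) ⟩
    - shift 𝟙 n - θ bern n ∎

  bern-parity : bern ⊕ shift 𝟙 ≗ alt bern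
  bern-parity = ⋆-cancelʳ {g = alt (exp 1)} refl λ n → begin
    ((bern ⊕ shift 𝟙) ⋆ alt (exp 1)) n
      ≡⟨ ⋆-congʳ (alt (exp 1)) (λ k → trans (+-comm (bern k) (shift 𝟙 k)) (sym (bern⋆exp₀ k))) n ⟩
    ((bern ⋆ exp 0) ⋆ alt (exp 1)) n        ≡⟨ ⋆-assoc bern (exp 0) (alt (exp 1)) n ⟩
    (bern ⋆ (exp 0 ⋆ alt (exp 1))) n
      ≡⟨ ⋆-congˡ bern (λ k → trans (⋆-comm (exp 0) (alt (exp 1)) k) (alt-exp₁⋆exp₀ k)) n ⟩
    (bern ⋆ exp 1) n                        ≡⟨ bern⋆exp₁ n ⟩
    𝟙 n                                     ≡⟨ alt-𝟙 n ⟨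
    alt 𝟙 n                                 ≡⟨ cong (sign n *_) (bern⋆exp₁ n) ⟨
    alt (bern ⋆ exp 1) n                    ≡⟨ alt-⋆ bern (exp 1) n ⟩
    (alt bern ⋆ alt (exp 1)) n              ∎

  B-odd : ∀ k → B (suc (2 ℕ.* suc k)) ≡ 0ℚ
  B-odd k = begin
    B j                                      ≡⟨ *-identityʳ (B j) ⟨
    B j * 1ℚ                                 ≡⟨ cong (B j *_) (ℕ→ℚ*1/ℕ≡1 (j !) {{j !≢0}}) ⟨
    B j * (ℕ→ℚ (j !) * 1/ j !)
      ≡⟨ solve 3 (λ b m e → b :* (m :* e) := m :* (b :* e)) refl (B j) (ℕ→ℚ (j !)) (1/ j !) ⟩
    ℕ→ℚ (j !) * bern j                       ≡⟨ cong (ℕ→ℚ (j !) *_) bern-j≡0 ⟩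
    ℕ→ℚ (j !) * 0ℚ                           ≡⟨ *-zeroʳ (ℕ→ℚ (j !)) ⟩
    0ℚ                                       ∎
    where
    j : ℕ
    j = suc (2 ℕ.* suc k)
    bern-j≡0 : bern j ≡ 0ℚ
    bern-j≡0 = x≡-x⇒x≡0 (begin
      bern j                          ≡⟨ +-identityʳ (bern j) ⟨
      bern j + shift 𝟙 j              ≡⟨ bern-parity j ⟩
      - sign (2 ℕ.* suc k) * bern j   ≡⟨ cong (λ s → - s * bern j) (sign-even (suc k)) ⟩
      - 1ℚ * bern j                   ≡⟨ solve 1 (λ b → :- con 1ℚ :* b := :- b) refl (bern j) ⟩
      - bern j                        ∎)

  sumTo-summand≡⋆exp₂ : ∀ n → sumTo n (summand n) ≡ ((θ bern ⊕ ⊖ bern) ⋆ exp 2) n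
  sumTo-summand≡⋆exp₂ n = sumTo-cong n split
    where
    split : ∀ i → i ≤ n → summand n i ≡ (θ bern ⊕ ⊖ bern) i * exp 2 (n ∸ i)
    split i i≤n = begin
      (ℕ→ℚ i - 1ℚ) * B i * 1/ℕ ((suc (suc n) ∸ i) ! ℕ.* i !) {{(suc (suc n) ∸ i) !* i !≢0}}
        ≡⟨ cong (λ m → (ℕ→ℚ i - 1ℚ) * B i * 1/ℕ (m ! ℕ.* i !) {{m !* i !≢0}})
                (ℕ.+-∸-assoc 2 i≤n) ⟩
      (ℕ→ℚ i - 1ℚ) * B i * 1/ℕ ((2 ℕ.+ (n ∸ i)) ! ℕ.* i !) {{(2 ℕ.+ (n ∸ i)) !* i !≢0}}
        ≡⟨ cong ((ℕ→ℚ i - 1ℚ) * B i *_)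
             (1/ℕ-* ((2 ℕ.+ (n ∸ i)) !) (i !)
                {{(2 ℕ.+ (n ∸ i)) !≢0}} {{i !≢0}} {{(2 ℕ.+ (n ∸ i)) !* i !≢0}}) ⟩
      (ℕ→ℚ i - 1ℚ) * B i * (exp 2 (n ∸ i) * 1/ i !)
        ≡⟨ solve 4 (λ a b e f → (a :- con 1ℚ) :* b :* (e :* f) := (a :* (b :* f) :+ (:- (b :* f))) :* e) refl
             (ℕ→ℚ i) (B i) (exp 2 (n ∸ i)) (1/ i !) ⟩
      (θ bern ⊕ ⊖ bern) i * exp 2 (n ∸ i) ∎

  θbern[1+n]≡B[1+n]/n! : ∀ n → θ bern (suc n) ≡ B (suc n) * 1/ n !
  θbern[1+n]≡B[1+n]/n! n = begin
    ℕ→ℚ (suc n) * (B (suc n) * 1/ suc n !)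
      ≡⟨ solve 3 (λ a b e → a :* (b :* e) := b :* (a :* e)) refl (ℕ→ℚ (suc n)) (B (suc n)) (1/ suc n !) ⟩
    B (suc n) * (ℕ→ℚ (suc n) * 1/ suc n !)    ≡⟨ cong (B (suc n) *_) (suc*1/suc!≡1/! n) ⟩
    B (suc n) * 1/ n !                        ∎

  sumTo-summand : ∀ m → sumTo (suc m) (summand (suc m)) ≡ - (B (suc (suc m)) * 1/ suc m !)
  sumTo-summand m = begin
    sumTo (suc m) (summand (suc m))                     ≡⟨ sumTo-summand≡⋆exp₂ (suc m) ⟩
    shift ((θ bern ⊕ ⊖ bern) ⋆ exp 2) (suc (suc m))     ≡⟨ shift-θbern⊖bern⋆exp₂ (suc (suc m)) ⟩
    - 0ℚ - θ bern (suc (suc m))                         ≡⟨ +-identityˡ (- θ bern (suc (suc m))) ⟩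
    - θ bern (suc (suc m))                              ≡⟨ cong -_ (θbern[1+n]≡B[1+n]/n! (suc m)) ⟩
    - (B (suc (suc m)) * 1/ suc m !)                    ∎

  sumTo-summand-even : ∀ {n} k → 1 ≤ n → n ≡ 2 ℕ.* k → sumTo n (summand n) ≡ 0ℚ
  sumTo-summand-even zero    ()  refl
  sumTo-summand-even {suc m} (suc k) _ 1+m≡2[1+k] = begin
    sumTo (suc m) (summand (suc m))      ≡⟨ sumTo-summand m ⟩
    - (B (suc (suc m)) * 1/ suc m !)
      ≡⟨ cong (λ b → - (b * 1/ suc m !)) (trans (cong (B ∘ suc) 1+m≡2[1+k]) (B-odd k)) ⟩
    - (0ℚ * 1/ suc m !)                  ≡⟨ cong -_ (*-zeroˡ (1/ suc m !)) ⟩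
    0ℚ                                   ∎

  sumTo-summand-odd : ∀ {n} k → n ≡ suc (2 ℕ.* k) → sumTo n (summand n) ≡ rhsOdd n
  sumTo-summand-odd k refl = sumTo-summand (2 ℕ.* k)

open BernoulliGeneratingFunction using (sumTo-summand-even; sumTo-summand-odd)
open import Data.Nat using (ℕ; suc; _*_; _≤_)
open import Data.Rational using (ℚ; 0ℚ)
open import Data.Product using (_×_; _,_)
open import Relation.Binary.PropositionalEquality using (_≡_)

lemma3 : (n : ℕ) → 1 ≤ n →
    ((k : ℕ) → n ≡ 2 * k → sumTo n (summand n) ≡ 0ℚ)
      × ((k : ℕ) → n ≡ suc (2 * k) → sumTo n (summand n) ≡ rhsOdd n)
lemma3 n 1≤n = (λ k → sumTo-summand-even k 1≤n) , sumTo-summand-odd
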